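{- For every integer $n\ge 1$, the subsemigroup complex ${\cal H}(B(n))$ is pure of dimension $\binom{n}{2}+2n-1$; that is, every facet of ${\cal H}(B(n))$ has exactly $\binom{n}{2}+2n$ elements.
   Context: For $n\ge1$, $B(n)$ denotes the aperiodic Brandt semigroup: the set $(\{1,\dots,n\}\times\{1,\dots,n\})\cup\{0\}$, where $0$ is a zero element and $(i,j)(k,l)=(i,l)$ if $j=k$ and $(i,j)(k,l)=0$ otherwise. For a finite nonempty semigroup $S$ and $Y\subseteq S$, $Y^+$ denotes the subsemigroup generated by $Y$ (with $\emptyset^+=\emptyset$, the empty set being regarded as a subsemigroup). The subsemigroup complex ${\cal H}(S)=(S,H(S))$ is the simplicial complex with vertex set $S$ whose faces are the subsets $X\subseteq S$ admitting an enumeration $x_1,\dots,x_k$ such that $\emptyset\subset\{x_1\}^+\subset\{x_1,x_2\}^+\subset\cdots\subset\{x_1,\dots,x_k\}^+$ with all inclusions strict (equivalently, there is a chain of subsemigroups $S_0\subset S_1\subset\cdots\subset S_k$ with $x_i\in S_i\setminus S_{i-1}$ for all $i$). A facet is a face maximal under inclusion; the dimension of a face $X$ is $|X|-1$; the complex is pure if all facets have the same dimension, and its dimension is the maximum dimension of a face. -}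

module Defs where

open import Data.Nat using (ℕ; suc)
open import Data.Fin using (Fin; toℕ; _≟_)
open import Data.List using (List; length; take)
open import Data.List.Membership.Propositional using (_∈_)
open import Data.List.Relation.Unary.Unique.Propositional using (Unique)
open import Data.List.Relation.Binary.Permutation.Propositional using (_↭_)
open import Data.Product using (Σ; ∃; _×_)
open import Relation.Nullary using (¬_; yes; no)

data B (n : ℕ) : Set where
  𝟎    : B n
  pair : Fin n → Fin n → B n

_·_ : ∀ {n} → B n → B n → B n
𝟎 · _ = 𝟎
pair _ _ · 𝟎 = 𝟎
pair i j · pair k l with j ≟ k
... | yes _ = pair i l
... | no  _ = 𝟎

-- Y⁺ : the subsemigroup generated by Y (a list used as a finite set),
-- as a predicate on B n.  (The empty list generates the empty set.)
data ⟨_⟩⁺ {n : ℕ} (Y : List (B n)) : B n → Set where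
  gen : ∀ {s} → s ∈ Y → ⟨ Y ⟩⁺ s
  mul : ∀ {s t} → ⟨ Y ⟩⁺ s → ⟨ Y ⟩⁺ t → ⟨ Y ⟩⁺ (s · t)

_⊆ₚ_ : ∀ {n} → (B n → Set) → (B n → Set) → Set
P ⊆ₚ Q = ∀ s → P s → Q s

_⊂ₚ_ : ∀ {n} → (B n → Set) → (B n → Set) → Set
P ⊂ₚ Q = (P ⊆ₚ Q) × ∃ λ s → Q s × ¬ P s

ChainEnumeration : ∀ {n} → List (B n) → Set
ChainEnumeration e =
  (i : Fin (length e)) → ⟨ take (toℕ i) e ⟩⁺ ⊂ₚ ⟨ take (suc (toℕ i)) e ⟩⁺

-- Finite subsets of B n are duplicate-free lists; cardinality = length.
_⊆ₗ_ : ∀ {n} → List (B n) → List (B n) → Set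
X ⊆ₗ Y = ∀ {s} → s ∈ X → s ∈ Y

IsFace : ∀ {n} → List (B n) → Set
IsFace X = Unique X × Σ _ λ e → (e ↭ X) × ChainEnumeration e

IsFacet : ∀ {n} → List (B n) → Set
IsFacet {n} X = IsFace X × ((Y : List (B n)) → IsFace Y → X ⊆ₗ Y → Y ⊆ₗ X)

module Submission where

-- A pair (p , q) lies in the subsemigroup generated by S ⊆ B(n) iff q is reachable
-- from p along the pairs of S, read as edges of a digraph on Fin n; and 0, which
-- the empty set does not generate, can always be enumerated first in a chain.
-- Hence the faces of H(B n) are, up to 0, the independent edge lists: lists in which
-- no edge is implied by a walk through the earlier ones; facets correspond to
-- maximal independent lists.

open import Defs

open import Data.Fin using (Fin; toℕ)
import Data.Fin as Fin
open import Data.Nat using (ℕ; zero; suc; _+_; _*_; _≤_; _<_; _≥_; z≤n; s≤s)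
open import Data.Nat.Properties
  using (≤-refl; ≤-reflexive; ≤-trans; 1+n≰n; ≤-antisym; ≤-pred; +-suc; +-identityʳ)
open import Data.Nat.Combinatorics using (_C_; nC1≡n; nCk+nC[k+1]≡[n+1]C[k+1])
open import Data.Nat.Tactic.RingSolver using (solve-∀)
open import Data.List
  using (List; []; _∷_; length; filter; _++_; map; cartesianProduct; take; reverse; _ʳ++_; allFin)
open import Data.List.Properties
  using (filter-notAll; length-++; length-map; length-tabulate; ++-assoc; ++-identityʳ;
         ʳ++-defn; reverse-involutive)
open import Data.List.Membership.Propositional using (_∈_; _∉_; lose; find)
open import Data.List.Membership.Propositional.Properties
  using (∈-filter⁺; ∈-filter⁻; ∈-++⁺ˡ; ∈-++⁺ʳ; ∈-++⁻; ∈-cartesianProduct⁺; ∈-cartesianProduct⁻;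
         ∈-map⁺; ∈-map⁻; ∈-allFin)
open import Data.List.Relation.Binary.Subset.Propositional using (_⊆_)
open import Data.List.Relation.Unary.Any using (here; there; any?; satisfied)
import Data.List.Relation.Unary.Any as Any
import Data.List.Relation.Unary.All as All
open import Data.List.Relation.Unary.AllPairs using ([]; _∷_)
open import Data.List.Relation.Unary.Unique.Propositional using (Unique)
import Data.List.Relation.Unary.Unique.Propositional.Properties as Unique
open import Data.List.Relation.Binary.Permutation.Propositional using (_↭_; prep; ↭-sym; ↭-trans)
open import Data.List.Relation.Binary.Permutation.Propositional.Properties
  using (∈-resp-↭; ↭-reverse)
open import Data.Product using (_×_; _,_; proj₁; proj₂; ∃)
open import Data.Product.Properties using (≡-dec)
open import Data.Sum using (_⊎_; inj₁; inj₂; [_,_]′)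
open import Data.Empty using (⊥; ⊥-elim)
open import Data.Unit using (⊤; tt)
open import Function using (_∘_; id)
open import Relation.Nullary using (¬_; Dec; yes; no)
import Relation.Nullary.Decidable as Dec
open import Relation.Nullary.Decidable using (¬?; _×-dec_; _⊎-dec_)
open import Level using (0ℓ)
open import Relation.Unary using (Pred; Decidable)
open import Relation.Binary.Definitions using (DecidableEquality)
open import Relation.Binary.PropositionalEquality
  using (_≡_; _≢_; refl; sym; trans; cong; cong₂; subst; subst₂; module ≡-Reasoning)
open ≡-Reasoning

facetSize : ℕ → ℕ
facetSize k = k C 2 + 2 * k

suc-C2 : ∀ m → suc m C 2 ≡ m + m C 2
suc-C2 m = begin
  suc m C 2        ≡⟨ sym (nCk+nC[k+1]≡[n+1]C[k+1] m 1) ⟩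
  m C 1 + m C 2    ≡⟨ cong (_+ m C 2) (nC1≡n m) ⟩
  m + m C 2        ∎

-- Pairs from a disjoint union: inside the first part, inside the second, or across.
C2-+ : ∀ k l → (k + l) C 2 ≡ k C 2 + l C 2 + k * l
C2-+ zero    l = sym (+-identityʳ (l C 2))
C2-+ (suc k) l = begin
  suc (k + l) C 2                      ≡⟨ suc-C2 (k + l) ⟩
  (k + l) + (k + l) C 2                ≡⟨ cong ((k + l) +_) (C2-+ k l) ⟩
  (k + l) + (k C 2 + l C 2 + k * l)    ≡⟨ regroup k l (k C 2) (l C 2) ⟩
  (k + k C 2) + l C 2 + suc k * l      ≡⟨ cong (λ z → z + l C 2 + suc k * l) (sym (suc-C2 k)) ⟩
  suc k C 2 + l C 2 + suc k * l        ∎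
  where
  regroup : ∀ k l x y → k + l + (x + y + k * l) ≡ k + x + y + suc k * l
  regroup = solve-∀

-- The recursion behind the counting theorem: splitting k + l vertices into
-- two blocks, the facet size is the sum of the block sizes plus l * k.
facetSize-+ : ∀ k l → facetSize (k + l) ≡ facetSize k + facetSize l + l * k
facetSize-+ k l = begin
  (k + l) C 2 + 2 * (k + l)                    ≡⟨ cong (_+ 2 * (k + l)) (C2-+ k l) ⟩
  k C 2 + l C 2 + k * l + 2 * (k + l)          ≡⟨ regroup k l (k C 2) (l C 2) ⟩
  facetSize k + facetSize l + l * k            ∎
  where
  regroup : ∀ k l x y → x + y + k * l + 2 * (k + l) ≡ x + 2 * k + (y + 2 * l) + l * k
  regroup = solve-∀

filter-split : ∀ {A : Set} {P : Pred A 0ℓ} (P? : Decidable P) xs →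
               length (filter P? xs) + length (filter (¬? ∘ P?) xs) ≡ length xs
filter-split P? []       = refl
filter-split P? (x ∷ xs) with P? x
... | yes _ = cong suc (filter-split P? xs)
... | no  _ = trans (+-suc _ _) (cong suc (filter-split P? xs))

length-cartesianProduct : ∀ {A B : Set} (xs : List A) (ys : List B) →
                          length (cartesianProduct xs ys) ≡ length xs * length ys
length-cartesianProduct []       ys = refl
length-cartesianProduct (x ∷ xs) ys = begin
  length (map (x ,_) ys ++ cartesianProduct xs ys)          ≡⟨ length-++ (map (x ,_) ys) ⟩
  length (map (x ,_) ys) + length (cartesianProduct xs ys)
    ≡⟨ cong₂ _+_ (length-map (x ,_) ys) (length-cartesianProduct xs ys) ⟩
  length ys + length xs * length ys                        ∎

module UniqueLists {A : Set} (_≟_ : DecidableEquality A) where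

  remove : A → List A → List A
  remove x = filter (λ y → ¬? (y ≟ x))

  ∈-remove⁺ : ∀ {x y xs} → y ∈ xs → y ≢ x → y ∈ remove x xs
  ∈-remove⁺ {x} = ∈-filter⁺ (λ y → ¬? (y ≟ x))

  ∈-remove⁻ : ∀ {x y} xs → y ∈ remove x xs → y ∈ xs × y ≢ x
  ∈-remove⁻ {x} xs = ∈-filter⁻ (λ y → ¬? (y ≟ x)) {xs = xs}

  remove-shorter : ∀ {x} xs → x ∈ xs → length (remove x xs) < length xs
  remove-shorter {x} xs x∈xs =
    filter-notAll (λ y → ¬? (y ≟ x)) xs (Any.map (λ y≡x y≢x → y≢x (sym y≡x)) x∈xs)

  unique-length-≤ : ∀ {xs ys} → Unique xs → xs ⊆ ys → length xs ≤ length ys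
  unique-length-≤ {[]}     _           _  = z≤n
  unique-length-≤ {x ∷ xs} {ys} (x∉xs ∷ u) xs⊆ys =
    ≤-trans (s≤s (unique-length-≤ u xs⊆rest)) (remove-shorter ys (xs⊆ys (here refl)))
    where
    xs⊆rest : xs ⊆ remove x ys
    xs⊆rest y∈xs = ∈-remove⁺ (xs⊆ys (there y∈xs)) (λ y≡x → All.lookup x∉xs y∈xs (sym y≡x))

  unique-length-≡ : ∀ {xs ys} → Unique xs → Unique ys → xs ⊆ ys → ys ⊆ xs →
                    length xs ≡ length ys
  unique-length-≡ u v xs⊆ys ys⊆xs = ≤-antisym (unique-length-≤ u xs⊆ys) (unique-length-≤ v ys⊆xs)

module Digraph {V : Set} (_≟V_ : DecidableEquality V) where

  Edge : Set
  Edge = V × V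

  _≟E_ : DecidableEquality Edge
  _≟E_ = ≡-dec _≟V_ _≟V_

  open import Data.List.Membership.DecPropositional _≟E_ using (_∈?_)

  module UV = UniqueLists _≟V_
  module UE = UniqueLists _≟E_

  infixr 5 _▸_
  data Path (L : List Edge) : V → V → Set where
    edge : ∀ {p q} → (p , q) ∈ L → Path L p q
    _▸_  : ∀ {p q r} → Path L p q → Path L q r → Path L p r

  Path* : List Edge → V → V → Set
  Path* L p q = p ≡ q ⊎ Path L p q

  Implied : List Edge → Edge → Set
  Implied L e = Path L (proj₁ e) (proj₂ e)

  path-mono : ∀ {L L′} → L ⊆ L′ → ∀ {p q} → Path L p q → Path L′ p q
  path-mono L⊆L′ (edge m) = edge (L⊆L′ m)
  path-mono L⊆L′ (x ▸ y)  = path-mono L⊆L′ x ▸ path-mono L⊆L′ y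

  path*-mono : ∀ {L L′} → L ⊆ L′ → ∀ {p q} → Path* L p q → Path* L′ p q
  path*-mono L⊆L′ (inj₁ p≡q) = inj₁ p≡q
  path*-mono L⊆L′ (inj₂ x)   = inj₂ (path-mono L⊆L′ x)

  no-path-[] : ∀ {p q} → ¬ Path [] p q
  no-path-[] (edge ())
  no-path-[] (x ▸ _) = no-path-[] x

  _*▸_ : ∀ {L p q r} → Path* L p q → Path L q r → Path L p r
  inj₁ refl *▸ y = y
  inj₂ x    *▸ y = x ▸ y

  _▸*_ : ∀ {L p q r} → Path L p q → Path* L q r → Path L p r
  x ▸* inj₁ refl = x
  x ▸* inj₂ y    = x ▸ y

  path-∷⁻ : ∀ {u v L p q} → Path ((u , v) ∷ L) p q →
            Path L p q ⊎ (Path* L p u × Path* L v q)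
  path-∷⁻ (edge (here refl)) = inj₂ (inj₁ refl , inj₁ refl)
  path-∷⁻ (edge (there m))   = inj₁ (edge m)
  path-∷⁻ (x ▸ y) with path-∷⁻ x | path-∷⁻ y
  ... | inj₁ x′        | inj₁ y′        = inj₁ (x′ ▸ y′)
  ... | inj₁ x′        | inj₂ (y₁ , y₂) = inj₂ (inj₂ (x′ ▸* y₁) , y₂)
  ... | inj₂ (x₁ , x₂) | inj₁ y′        = inj₂ (x₁ , inj₂ (x₂ *▸ y′))
  ... | inj₂ (x₁ , _)  | inj₂ (_ , y₂)  = inj₂ (x₁ , y₂)

  path-∷⁺ : ∀ {u v L p q} → Path L p q ⊎ (Path* L p u × Path* L v q) →
            Path ((u , v) ∷ L) p q
  path-∷⁺ (inj₁ x)       = path-mono there x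
  path-∷⁺ (inj₂ (x , y)) = path*-mono there x *▸ (edge (here refl) ▸* path*-mono there y)

  path? : ∀ L p q → Dec (Path L p q)
  path*? : ∀ L p q → Dec (Path* L p q)
  path*? L p q = (p ≟V q) ⊎-dec path? L p q
  path? []            p q = no no-path-[]
  path? ((u , v) ∷ L) p q =
    Dec.map′ path-∷⁺ path-∷⁻ (path? L p q ⊎-dec (path*? L p u ×-dec path*? L v q))

  -- An edge list, latest edge first, in which no edge is implied by the earlier ones.
  Independent : List Edge → Set
  Independent []      = ⊤
  Independent (e ∷ L) = ¬ Implied L e × Independent L

  independent-unique : ∀ {L} → Independent L → Unique L
  independent-unique {[]}    _          = []
  independent-unique {e ∷ L} (e⇏ , iL) =
    All.tabulate (λ { e∈L refl → e⇏ (edge e∈L) }) ∷ independent-unique iL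

  independent-filter : ∀ {Q : Pred Edge 0ℓ} (Q? : Decidable Q) {L} →
                       Independent L → Independent (filter Q? L)
  independent-filter Q? {[]}    _         = tt
  independent-filter Q? {e ∷ L} (e⇏ , iL) with Q? e
  ... | yes _ = (λ x → e⇏ (path-mono (λ m → proj₁ (∈-filter⁻ Q? {xs = L} m)) x)) , independent-filter Q? iL
  ... | no  _ = independent-filter Q? iL

  Every : (Edge → Set) → List Edge → Set
  Every Q L = ∀ {e} → e ∈ L → Q e

  module Cut (P : V → Set) where

    Inside Outside Crossing : Edge → Set
    Inside   e = P (proj₁ e) × P (proj₂ e)
    Outside  e = ¬ P (proj₁ e) × ¬ P (proj₂ e)
    Crossing e = ¬ P (proj₁ e) × P (proj₂ e)

    Closed : List Edge → Set
    Closed L = ∀ {e} → e ∈ L → P (proj₁ e) → P (proj₂ e)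

    stays : ∀ {L s t} → Closed L → P s → Path L s t → P t
    stays closed Ps (edge m) = closed m Ps
    stays closed Ps (x ▸ y)  = stays closed (stays closed Ps x) y

    closed-++ : ∀ {K J} → Closed K → Closed J → Closed (K ++ J)
    closed-++ {K} cK cJ m with ∈-++⁻ K m
    ... | inj₁ mK = cK mK
    ... | inj₂ mJ = cJ mJ

    closed-into : ∀ {J} → Every (P ∘ proj₂) J → Closed J
    closed-into into m _ = into m

    closed-outside : ∀ {K} → Every (¬_ ∘ P ∘ proj₁) K → Closed K
    closed-outside out m Ps = ⊥-elim (out m Ps)

    -- Crossing edges cannot be chained, so a walk of crossing edges is one edge.
    crossing-walk : ∀ {X s t} → Every Crossing X → Path X s t → (s , t) ∈ X
    crossing-walk cross (edge m) = m
    crossing-walk cross (x ▸ y)  =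
      ⊥-elim (proj₁ (cross (crossing-walk cross y)) (proj₂ (cross (crossing-walk cross x))))

    independent-crossing : ∀ {X} → Unique X → Every Crossing X → Independent X
    independent-crossing {[]}    _          _     = tt
    independent-crossing {e ∷ X} (e∉X ∷ uX) cross =
      (λ x → All.lookup e∉X (crossing-walk (cross ∘ there) x) refl) ,
      independent-crossing uX (cross ∘ there)

    inside-walk : ∀ {K X s t} → Every Inside K → Every Crossing X → P s →
                  Path (K ++ X) s t → Path K s t
    inside-walk {K} inK cross Ps (edge m) with ∈-++⁻ K m
    ... | inj₁ mK = edge mK
    ... | inj₂ mX = ⊥-elim (proj₁ (cross mX) Ps)
    inside-walk {K} {X} inK cross Ps (x ▸ y) =
      inside-walk inK cross Ps x ▸ inside-walk inK cross (stays closed Ps x) y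
      where
      closed : Closed (K ++ X)
      closed = closed-++ (closed-into (proj₂ ∘ inK)) (closed-outside (proj₁ ∘ cross))

    independent-inside-++-crossing :
      ∀ {K X} → Independent K → Every Inside K → Unique X → Every Crossing X →
      Independent (K ++ X)
    independent-inside-++-crossing {[]}    _          _   uX cross = independent-crossing uX cross
    independent-inside-++-crossing {e ∷ K} (e⇏ , iK) inK uX cross =
      (λ x → e⇏ (inside-walk (inK ∘ there) cross (proj₁ (inK (here refl))) x)) ,
      independent-inside-++-crossing iK (inK ∘ there) uX cross

    outside-walk : ∀ {K J s t} → Every Outside K → Every (P ∘ proj₂) J → ¬ P s →
                   Path (K ++ J) s t → Path K s t ⊎ P t
    outside-walk {K} outK into ¬Ps (edge m) with ∈-++⁻ K m
    ... | inj₁ mK = inj₁ (edge mK)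
    ... | inj₂ mJ = inj₂ (into mJ)
    outside-walk {K} {J} outK into ¬Ps (x ▸ y) with outside-walk outK into ¬Ps x
    ... | inj₂ Pr = inj₂ (stays closed Pr y)
      where
      closed : Closed (K ++ J)
      closed = closed-++ (closed-outside (proj₁ ∘ outK)) (closed-into into)
    ... | inj₁ x′ with outside-walk outK into (¬P-end x′) y
      where
      ¬P-end : ∀ {p q} → Path K p q → ¬ P q
      ¬P-end (edge m) = proj₂ (outK m)
      ¬P-end (_ ▸ z)  = ¬P-end z
    ...   | inj₁ y′ = inj₁ (x′ ▸ y′)
    ...   | inj₂ Pt = inj₂ Pt

    independent-outside-++ :
      ∀ {K J} → Independent K → Every Outside K → Independent J → Every (P ∘ proj₂) J →
      Independent (K ++ J)
    independent-outside-++ {[]}    _          _    iJ _    = iJ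
    independent-outside-++ {e ∷ K} (e⇏ , iK) outK iJ into =
      [ e⇏ , proj₂ (outK (here refl)) ]′ ∘ outside-walk (outK ∘ there) into (proj₁ (outK (here refl))) ,
      independent-outside-++ iK (outK ∘ there) iJ into

    independent-glued :
      ∀ {LB LA X a b} → Independent LB → Every Outside LB → Independent LA → Every Inside LA →
      Unique X → Every Crossing X → P a → ¬ P b → Independent ((a , b) ∷ LB ++ LA ++ X)
    independent-glued {LB} {LA} {X} iB outB iA inA uX cross Pa ¬Pb =
      (λ x → ¬Pb (stays closed Pa x)) ,
      independent-outside-++ iB outB (independent-inside-++-crossing iA inA uX cross) into
      where
      into : Every (P ∘ proj₂) (LA ++ X)
      into m with ∈-++⁻ LA m
      ... | inj₁ mA = proj₂ (inA mA)
      ... | inj₂ mX = proj₂ (cross mX)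
      closed : Closed (LB ++ LA ++ X)
      closed = closed-++ (closed-outside (proj₁ ∘ outB)) (closed-into into)

  Within : List V → List Edge → Set
  Within W = Every (λ e → proj₁ e ∈ W × proj₂ e ∈ W)

  MaximalOn : List V → List Edge → Set
  MaximalOn W F =
    Independent F × Within W F × (∀ L → Independent L → Within W L → F ⊆ L → L ⊆ F)

  maximal-connected : ∀ {W F} → MaximalOn W F → ∀ {p q} → p ∈ W → q ∈ W → Path F p q
  maximal-connected {W} {F} (iF , wF , maxF) {p} {q} p∈W q∈W with path? F p q
  ... | yes x = x
  ... | no  ¬x = ⊥-elim (¬x (edge (maxF ((p , q) ∷ F) (¬x , iF) within there (here refl))))
    where
    within : Within W ((p , q) ∷ F)
    within (here refl) = p∈W , q∈W
    within (there m)   = wF m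

  -- A maximal list on a non-empty W is not empty: a loop could be added.
  maximal-nonempty : ∀ {W v} → v ∈ W → ¬ MaximalOn W []
  maximal-nonempty {W} {v} v∈W (_ , _ , maxF) =
    loop∉[] (maxF ((v , v) ∷ []) (no-path-[] , tt) within (λ ()) (here refl))
    where
    within : Within W ((v , v) ∷ [])
    within (here refl) = v∈W , v∈W
    loop∉[] : (v , v) ∉ []
    loop∉[] ()

  -- If the latest edge of a maximal list is a loop (a , a) then a is the only
  -- vertex: any other vertex c would give a walk a → c → a avoiding the loop.
  maximal-loop : ∀ {W a G} → Unique W → MaximalOn W ((a , a) ∷ G) → length W ≡ 1 × G ≡ []
  maximal-loop {W} {a} {G} uW maxF@((a⇏ , _) , wF , _) = length-W , G-empty G no-edge
    where
    a∈W : a ∈ W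
    a∈W = proj₁ (wF (here refl))
    only-a : ∀ {c} → c ∈ W → c ≡ a
    only-a {c} c∈W with c ≟V a
    ... | yes c≡a = c≡a
    ... | no  c≢a = ⊥-elim (a⇏ (away (path-∷⁻ (maximal-connected maxF a∈W c∈W))
                               ▸ back (path-∷⁻ (maximal-connected maxF c∈W a∈W))))
      where
      away : Path G a c ⊎ (Path* G a a × Path* G a c) → Path G a c
      away (inj₁ x)                = x
      away (inj₂ (_ , inj₁ a≡c))   = ⊥-elim (c≢a (sym a≡c))
      away (inj₂ (_ , inj₂ x))     = x
      back : Path G c a ⊎ (Path* G c a × Path* G a a) → Path G c a
      back (inj₁ x)                = x
      back (inj₂ (inj₁ c≡a , _))   = ⊥-elim (c≢a c≡a)
      back (inj₂ (inj₂ x , _))     = x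
    no-edge : ∀ {e} → e ∈ G → ⊥
    no-edge {p , q} m with only-a (proj₁ (wF (there m))) | only-a (proj₂ (wF (there m)))
    ... | refl | refl = a⇏ (edge m)
    G-empty : ∀ H → (∀ {e} → e ∈ H → ⊥) → H ≡ []
    G-empty []      _     = refl
    G-empty (e ∷ H) empty = ⊥-elim (empty (here refl))
    length-W : length W ≡ 1
    length-W = ≤-antisym (UV.unique-length-≤ {ys = a ∷ []} uW (here ∘ only-a)) (nonempty a∈W)
      where
      nonempty : ∀ {x : V} {xs} → x ∈ xs → 1 ≤ length xs
      nonempty (here _)  = s≤s z≤n
      nonempty (there _) = s≤s z≤n

  within-mono : ∀ {W₁ W₂ L} → W₁ ⊆ W₂ → Within W₁ L → Within W₂ L
  within-mono W₁⊆W₂ w m = W₁⊆W₂ (proj₁ (w m)) , W₁⊆W₂ (proj₂ (w m))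

  within-++ : ∀ {W K J} → Within W K → Within W J → Within W (K ++ J)
  within-++ {K = K} wK wJ m with ∈-++⁻ K m
  ... | inj₁ mK = wK mK
  ... | inj₂ mJ = wJ mJ

  within-cartesianProduct : ∀ {W₁ W₂ L} → L ⊆ cartesianProduct W₁ W₂ →
                            Every (λ e → proj₁ e ∈ W₁ × proj₂ e ∈ W₂) L
  within-cartesianProduct {W₁} {W₂} L⊆ m = ∈-cartesianProduct⁻ W₁ W₂ (L⊆ m)

  -- The latest edge (a , b), a ≢ b, of a maximal list (a , b) ∷ G on W splits W
  -- into the vertices WA reachable from a in G and the rest WB.  Maximality then
  -- forces G to consist of a maximal list GA on WA, a maximal list GB on WB and
  -- all edges GX from WB to WA.
  module Split {W a b G} (uW : Unique W) (a≢b : a ≢ b) (maxF : MaximalOn W ((a , b) ∷ G)) where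

    P : V → Set
    P = Path* G a

    P? : Decidable P
    P? = path*? G a

    open Cut P

    a⇏b : ¬ Path G a b
    a⇏b = proj₁ (proj₁ maxF)

    iG : Independent G
    iG = proj₂ (proj₁ maxF)

    wF : Within W ((a , b) ∷ G)
    wF = proj₁ (proj₂ maxF)

    Pa : P a
    Pa = inj₁ refl

    ¬Pb : ¬ P b
    ¬Pb (inj₁ a≡b) = a≢b a≡b
    ¬Pb (inj₂ x)   = a⇏b x

    closedG : Closed G
    closedG m Pp = inj₂ (Pp *▸ edge m)

    WA WB : List V
    WA = filter P? W
    WB = filter (¬? ∘ P?) W

    a∈WA : a ∈ WA
    a∈WA = ∈-filter⁺ P? (proj₁ (wF (here refl))) Pa

    b∈WB : b ∈ WB
    b∈WB = ∈-filter⁺ (¬? ∘ P?) (proj₂ (wF (here refl))) ¬Pb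

    WA⊆W : WA ⊆ W
    WA⊆W m = proj₁ (∈-filter⁻ P? {xs = W} m)

    WB⊆W : WB ⊆ W
    WB⊆W m = proj₁ (∈-filter⁻ (¬? ∘ P?) {xs = W} m)

    GA G¬ GX GB : List Edge
    GA = filter (P? ∘ proj₁) G
    G¬ = filter (¬? ∘ P? ∘ proj₁) G
    GX = filter (P? ∘ proj₂) G¬
    GB = filter (¬? ∘ P? ∘ proj₂) G¬

    ∈GA⁺ : ∀ {e} → e ∈ G → P (proj₁ e) → e ∈ GA
    ∈GA⁺ = ∈-filter⁺ (P? ∘ proj₁)

    ∈GX⁺ : ∀ {e} → e ∈ G → Crossing e → e ∈ GX
    ∈GX⁺ m (¬Ps , Pt) = ∈-filter⁺ (P? ∘ proj₂) (∈-filter⁺ (¬? ∘ P? ∘ proj₁) m ¬Ps) Pt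

    ∈GB⁺ : ∀ {e} → e ∈ G → Outside e → e ∈ GB
    ∈GB⁺ m (¬Ps , ¬Pt) = ∈-filter⁺ (¬? ∘ P? ∘ proj₂) (∈-filter⁺ (¬? ∘ P? ∘ proj₁) m ¬Ps) ¬Pt

    ∈G¬⁻ : ∀ {e} → e ∈ G¬ → e ∈ G × ¬ P (proj₁ e)
    ∈G¬⁻ = ∈-filter⁻ (¬? ∘ P? ∘ proj₁) {xs = G}

    ∈GA⁻ : ∀ {e} → e ∈ GA → e ∈ G × Inside e
    ∈GA⁻ m with ∈-filter⁻ (P? ∘ proj₁) {xs = G} m
    ... | e∈G , Ps = e∈G , Ps , closedG e∈G Ps

    ∈GX⁻ : ∀ {e} → e ∈ GX → e ∈ G × Crossing e
    ∈GX⁻ m with ∈-filter⁻ (P? ∘ proj₂) {xs = G¬} m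
    ... | e∈G¬ , Pt = proj₁ (∈G¬⁻ e∈G¬) , proj₂ (∈G¬⁻ e∈G¬) , Pt

    ∈GB⁻ : ∀ {e} → e ∈ GB → e ∈ G × Outside e
    ∈GB⁻ m with ∈-filter⁻ (¬? ∘ P? ∘ proj₂) {xs = G¬} m
    ... | e∈G¬ , ¬Pt = proj₁ (∈G¬⁻ e∈G¬) , proj₂ (∈G¬⁻ e∈G¬) , ¬Pt

    -- No edge of G leaves the set reachable from a.
    classify : ∀ {e} → e ∈ G → e ∈ GB ⊎ e ∈ GA ⊎ e ∈ GX
    classify {e} m with P? (proj₁ e) | P? (proj₂ e)
    ... | yes Ps | _      = inj₂ (inj₁ (∈GA⁺ m Ps))
    ... | no ¬Ps | yes Pt = inj₂ (inj₂ (∈GX⁺ m (¬Ps , Pt)))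
    ... | no ¬Ps | no ¬Pt = inj₁ (∈GB⁺ m (¬Ps , ¬Pt))

    outside-of : ∀ {L} → Within WB L → Every Outside L
    outside-of w m = proj₂ (∈-filter⁻ (¬? ∘ P?) {xs = W} (proj₁ (w m))) ,
                     proj₂ (∈-filter⁻ (¬? ∘ P?) {xs = W} (proj₂ (w m)))

    inside-of : ∀ {L} → Within WA L → Every Inside L
    inside-of w m = proj₂ (∈-filter⁻ P? {xs = W} (proj₁ (w m))) ,
                    proj₂ (∈-filter⁻ P? {xs = W} (proj₂ (w m)))

    crossing-of : ∀ {X} → X ⊆ cartesianProduct WB WA → Every Crossing X
    crossing-of X⊆ m with within-cartesianProduct X⊆ m
    ... | s∈WB , t∈WA = proj₂ (∈-filter⁻ (¬? ∘ P?) {xs = W} s∈WB) ,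
                        proj₂ (∈-filter⁻ P? {xs = W} t∈WA)

    -- The use of maximality: replacing the parts of G by larger lists of the
    -- same kinds yields an independent list on W, which must lie inside G.
    glued-⊆ : ∀ {LB LA X} → Independent LB → Within WB LB → Independent LA → Within WA LA →
              Unique X → X ⊆ cartesianProduct WB WA →
              GB ⊆ LB → GA ⊆ LA → GX ⊆ X → LB ++ LA ++ X ⊆ G
    glued-⊆ {LB} {LA} {X} iB wB iA wA uX X⊆ GB⊆ GA⊆ GX⊆ {e} m =
      in-G (proj₂ (proj₂ maxF) L iL wL F⊆L (there m))
      where
      L : List Edge
      L = (a , b) ∷ LB ++ LA ++ X
      iL : Independent L
      iL = independent-glued iB (outside-of wB) iA (inside-of wA) uX (crossing-of X⊆) Pa ¬Pb
      wL : Within W L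
      wL (here refl) = wF (here refl)
      wL (there m′)  = within-++ (within-mono WB⊆W wB)
                         (within-++ (within-mono WA⊆W wA)
                           (λ mX → let s , t = within-cartesianProduct X⊆ mX in WB⊆W s , WA⊆W t)) m′
      F⊆L : (a , b) ∷ G ⊆ L
      F⊆L (here refl) = here refl
      F⊆L (there m′) with classify m′
      ... | inj₁ mB        = there (∈-++⁺ˡ (GB⊆ mB))
      ... | inj₂ (inj₁ mA) = there (∈-++⁺ʳ LB (∈-++⁺ˡ (GA⊆ mA)))
      ... | inj₂ (inj₂ mX) = there (∈-++⁺ʳ LB (∈-++⁺ʳ LA (GX⊆ mX)))
      closed : Closed (LB ++ LA ++ X)
      closed = closed-++ (closed-outside (proj₁ ∘ outside-of wB))
                 (closed-++ (closed-into (proj₂ ∘ inside-of wA)) (closed-into (proj₂ ∘ crossing-of X⊆)))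
      in-G : e ∈ (a , b) ∷ G → e ∈ G
      in-G (here refl) = ⊥-elim (¬Pb (closed m Pa))
      in-G (there e∈G) = e∈G

    iGA : Independent GA
    iGA = independent-filter (P? ∘ proj₁) iG

    iGB : Independent GB
    iGB = independent-filter (¬? ∘ P? ∘ proj₂) (independent-filter (¬? ∘ P? ∘ proj₁) iG)

    wGA : Within WA GA
    wGA m with ∈GA⁻ m
    ... | e∈G , Ps , Pt = ∈-filter⁺ P? (proj₁ (wF (there e∈G))) Ps ,
                          ∈-filter⁺ P? (proj₂ (wF (there e∈G))) Pt

    wGB : Within WB GB
    wGB m with ∈GB⁻ m
    ... | e∈G , ¬Ps , ¬Pt = ∈-filter⁺ (¬? ∘ P?) (proj₁ (wF (there e∈G))) ¬Ps ,
                            ∈-filter⁺ (¬? ∘ P?) (proj₂ (wF (there e∈G))) ¬Pt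

    GX⊆WB×WA : GX ⊆ cartesianProduct WB WA
    GX⊆WB×WA m with ∈GX⁻ m
    ... | e∈G , ¬Ps , Pt = ∈-cartesianProduct⁺ (∈-filter⁺ (¬? ∘ P?) (proj₁ (wF (there e∈G))) ¬Ps)
                                               (∈-filter⁺ P? (proj₂ (wF (there e∈G))) Pt)

    uWB×WA : Unique (cartesianProduct WB WA)
    uWB×WA = Unique.cartesianProduct⁺ (Unique.filter⁺ (¬? ∘ P?) uW) (Unique.filter⁺ P? uW)

    crossing-complete : cartesianProduct WB WA ⊆ GX
    crossing-complete m =
      ∈GX⁺ (glued-⊆ iGB wGB iGA wGA uWB×WA id id id GX⊆WB×WA
                    (∈-++⁺ʳ GB (∈-++⁺ʳ GA m)))
           (crossing-of id m)

    uGX : Unique GX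
    uGX = Unique.filter⁺ (P? ∘ proj₂) (Unique.filter⁺ (¬? ∘ P? ∘ proj₁) (independent-unique iG))

    maximal-A : MaximalOn WA GA
    maximal-A = iGA , wGA , λ L iL wL GA⊆L m →
      ∈GA⁺ (glued-⊆ iGB wGB iL wL uGX GX⊆WB×WA id GA⊆L id (∈-++⁺ʳ GB (∈-++⁺ˡ m)))
           (proj₁ (inside-of wL m))

    maximal-B : MaximalOn WB GB
    maximal-B = iGB , wGB , λ L iL wL GB⊆L m →
      ∈GB⁺ (glued-⊆ iL wL iGA wGA uGX GX⊆WB×WA GB⊆L id id (∈-++⁺ˡ m))
           (outside-of wL m)

    length-GX : length GX ≡ length WB * length WA
    length-GX = trans (UE.unique-length-≡ uGX uWB×WA GX⊆WB×WA crossing-complete)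
                      (length-cartesianProduct WB WA)

    length-split : suc (length ((a , b) ∷ G)) ≡
                   suc (length GA) + suc (length GB) + length WB * length WA
    length-split = begin
      suc (suc (length G))
        ≡⟨ cong (suc ∘ suc) (sym (filter-split (P? ∘ proj₁) G)) ⟩
      suc (suc (length GA + length G¬))
        ≡⟨ cong (λ x → suc (suc (length GA + x))) (sym (filter-split (P? ∘ proj₂) G¬)) ⟩
      suc (suc (length GA + (length GX + length GB)))
        ≡⟨ cong (λ x → suc (suc (length GA + (x + length GB)))) length-GX ⟩
      suc (suc (length GA + (length WB * length WA + length GB)))
        ≡⟨ regroup (length GA) (length GB) (length WB * length WA) ⟩
      suc (length GA) + suc (length GB) + length WB * length WA
        ∎
      where
      regroup : ∀ x y z → suc (suc (x + (z + y))) ≡ suc x + suc y + z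
      regroup = solve-∀

    length-W : length WA + length WB ≡ length W
    length-W = filter-split P? W

    WA-shorter : length WA < length W
    WA-shorter = filter-notAll P? W
                   (Any.map (λ b≡c → subst (¬_ ∘ P) b≡c ¬Pb) (proj₂ (wF (here refl))))

    WB-shorter : length WB < length W
    WB-shorter = filter-notAll (¬? ∘ P?) W
                   (Any.map (λ a≡c ¬Pc → ¬Pc (subst P a≡c Pa)) (proj₁ (wF (here refl))))

  -- By strong induction on |W|: the
  -- latest edge is either a loop and |W| = 1, or it splits W as in Split.
  maximal-size : ∀ {W F v} → Unique W → v ∈ W → MaximalOn W F →
                 suc (length F) ≡ facetSize (length W)
  maximal-size {W} = by-bound (length W) ≤-refl
    where
    by-bound : ∀ k {W F v} → length W ≤ k → Unique W → v ∈ W → MaximalOn W F →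
               suc (length F) ≡ facetSize (length W)
    by-bound _ {F = []} _ _ v∈W maxF = ⊥-elim (maximal-nonempty v∈W maxF)
    by-bound zero {W = _ ∷ _} () _ _ _
    by-bound (suc k) {W} {(a , b) ∷ G} bound uW _ maxF with a ≟V b
    ... | yes refl with maximal-loop uW maxF
    ...   | |W|≡1 , refl = cong facetSize (sym |W|≡1)
    by-bound (suc k) {W} {(a , b) ∷ G} bound uW _ maxF | no a≢b = begin
      suc (length ((a , b) ∷ G))
        ≡⟨ length-split ⟩
      suc (length GA) + suc (length GB) + length WB * length WA
        ≡⟨ cong₂ (λ x y → x + y + length WB * length WA) size-A size-B ⟩
      facetSize (length WA) + facetSize (length WB) + length WB * length WA
        ≡⟨ sym (facetSize-+ (length WA) (length WB)) ⟩
      facetSize (length WA + length WB)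
        ≡⟨ cong facetSize length-W ⟩
      facetSize (length W)
        ∎
      where
      open Split uW a≢b maxF
      size-A : suc (length GA) ≡ facetSize (length WA)
      size-A = by-bound k (≤-pred (≤-trans WA-shorter bound)) (Unique.filter⁺ P? uW) a∈WA maximal-A
      size-B : suc (length GB) ≡ facetSize (length WB)
      size-B = by-bound k (≤-pred (≤-trans WB-shorter bound)) (Unique.filter⁺ (¬? ∘ P?) uW) b∈WB maximal-B

  IndependentSet : List Edge → Set
  IndependentSet S = ∃ λ L → Independent L × L ⊆ S × S ⊆ L

  -- x can serve as the latest edge of an independent ordering of S.
  LatestIn : List Edge → Edge → Set
  LatestIn S x = x ∈ S × ¬ Implied (UE.remove x S) x × IndependentSet (UE.remove x S)

  latest⇒independent : ∀ {S x} → LatestIn S x → IndependentSet S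
  latest⇒independent {S} {x} (x∈S , x⇏ , L , iL , L⊆ , ⊆L) = x ∷ L , (x⇏ ∘ path-mono L⊆ , iL) , ⊆S , S⊆
    where
    ⊆S : x ∷ L ⊆ S
    ⊆S (here refl) = x∈S
    ⊆S (there m)   = proj₁ (UE.∈-remove⁻ S (L⊆ m))
    S⊆ : S ⊆ x ∷ L
    S⊆ {y} m with y ≟E x
    ... | yes y≡x = here y≡x
    ... | no  y≢x = there (⊆L (UE.∈-remove⁺ m y≢x))

  independent⇒latest : ∀ {S s} → IndependentSet S → s ∈ S → ∃ (LatestIn S)
  independent⇒latest ([] , _ , _ , S⊆) s∈S with S⊆ s∈S
  ... | ()
  independent⇒latest {S} (x ∷ L , (x⇏ , iL′) , ⊆S , S⊆) _ =
    x , ⊆S (here refl) , x⇏ ∘ path-mono rest⊆L , L , iL′ , L⊆rest , rest⊆L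
    where
    L⊆rest : L ⊆ UE.remove x S
    L⊆rest m = UE.∈-remove⁺ (⊆S (there m))
                 (λ { refl → x⇏ (edge m) })
    rest⊆L : UE.remove x S ⊆ L
    rest⊆L m with UE.∈-remove⁻ S m
    ... | y∈S , y≢x with S⊆ y∈S
    ...   | here y≡x = ⊥-elim (y≢x y≡x)
    ...   | there y∈L = y∈L

  -- Independence of a set is decidable: try every element as the latest edge.
  -- The recursion is on the length of S.
  independentSet? : ∀ S → Dec (IndependentSet S)
  independentSet? S = by-bound (length S) S ≤-refl
    where
    by-bound : ∀ k S → length S ≤ k → Dec (IndependentSet S)
    by-bound _       []      _     = yes ([] , tt , (λ ()) , (λ ()))
    by-bound zero    (_ ∷ _) ()
    by-bound (suc k) S@(_ ∷ _) bound =
      Dec.map′ (latest⇒independent ∘ proj₂) (λ iS → independent⇒latest iS (here refl))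
               (Dec.map′ satisfied (λ (x , lx) → lose (proj₁ lx) lx) (any? latest? S))
      where
      latest? : ∀ x → Dec (LatestIn S x)
      latest? x with x ∈? S
      ... | no  x∉S = no (x∉S ∘ proj₁)
      ... | yes x∈S = Dec.map′ (x∈S ,_) proj₂
        (¬? (path? (UE.remove x S) (proj₁ x) (proj₂ x)) ×-dec
         by-bound k (UE.remove x S) (≤-pred (≤-trans (UE.remove-shorter S x∈S) bound)))

  Extendable : List V → List Edge → Set
  Extendable W F = ∃ λ e → e ∈ cartesianProduct W W × e ∉ F × IndependentSet (e ∷ F)

  extendable? : ∀ W F → Dec (Extendable W F)
  extendable? W F = Dec.map′ find (λ (e , e∈ , rest) → lose e∈ rest)
    (any? (λ e → ¬? (e ∈? F) ×-dec independentSet? (e ∷ F)) (cartesianProduct W W))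

  -- An independent list on W that cannot be extended is maximal: an edge y of a
  -- larger independent list L yields the independent set y ∷ F inside L.
  unextendable⇒maximal : ∀ {W F} → Independent F → Within W F → ¬ Extendable W F → MaximalOn W F
  unextendable⇒maximal {W} {F} iF wF ¬ext = iF , wF , maximal
    where
    maximal : ∀ L → Independent L → Within W L → F ⊆ L → L ⊆ F
    maximal L iL wL F⊆L {y} y∈L with y ∈? F
    ... | yes y∈F = y∈F
    ... | no  y∉F = ⊥-elim (¬ext (y , ∈-cartesianProduct⁺ (proj₁ (wL y∈L)) (proj₂ (wL y∈L)) , y∉F ,
                                  L′ , independent-filter in-yF? iL , L′⊆ , ⊆L′))
      where
      in-yF? : ∀ e → Dec (e ∈ y ∷ F)
      in-yF? e = e ∈? (y ∷ F)
      L′ : List Edge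
      L′ = filter in-yF? L
      L′⊆ : L′ ⊆ y ∷ F
      L′⊆ m = proj₂ (∈-filter⁻ in-yF? {xs = L} m)
      ⊆L′ : y ∷ F ⊆ L′
      ⊆L′ (here refl) = ∈-filter⁺ in-yF? y∈L (here refl)
      ⊆L′ (there m)   = ∈-filter⁺ in-yF? (F⊆L m) (there m)

  -- Maximal independent lists on W exist: starting from the empty list, add
  -- edges while possible.  Each step adds a new edge of W × W, so the process
  -- stops after at most |W|² steps.
  maximal-exists : ∀ W → ∃ (MaximalOn W)
  maximal-exists W = grow (length W²) [] tt (λ ()) ≤-refl
    where
    W² : List Edge
    W² = cartesianProduct W W
    grow : ∀ k F → Independent F → Within W F → length W² ≤ length F + k → ∃ (MaximalOn W)
    grow k F iF wF bound with extendable? W F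
    ... | no ¬ext = F , unextendable⇒maximal iF wF ¬ext
    ... | yes (e , e∈W² , e∉F , L , iL , L⊆ , ⊆L) = step k bound
      where
      length-L : length L ≡ suc (length F)
      length-L = UE.unique-length-≡ (independent-unique iL)
                   (All.tabulate (λ { m refl → e∉F m }) ∷ independent-unique iF) L⊆ ⊆L
      wL : Within W L
      wL m with L⊆ m
      ... | here refl = ∈-cartesianProduct⁻ W W e∈W²
      ... | there m′  = wF m′
      L≤W² : length L ≤ length W²
      L≤W² = UE.unique-length-≤ (independent-unique iL)
               (λ m → ∈-cartesianProduct⁺ (proj₁ (wL m)) (proj₂ (wL m)))
      step : ∀ j → length W² ≤ length F + j → ∃ (MaximalOn W)
      step zero    bound′ = ⊥-elim (1+n≰n (≤-trans (≤-reflexive (sym length-L))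
                                    (≤-trans L≤W² (≤-trans bound′ (≤-reflexive (+-identityʳ _))))))
      step (suc j) bound′ = grow j L iL wL
        (≤-trans bound′ (≤-reflexive (trans (+-suc (length F) j) (cong (_+ j) (sym length-L)))))

module Brandt (n : ℕ) where

  open Digraph (Fin._≟_ {n})

  _≟B_ : DecidableEquality (B n)
  𝟎        ≟B 𝟎          = yes refl
  𝟎        ≟B pair _ _   = no (λ ())
  pair _ _ ≟B 𝟎          = no (λ ())
  pair p q ≟B pair p′ q′ = Dec.map′ (λ (p≡ , q≡) → cong₂ pair p≡ q≡) (λ { refl → refl , refl })
                                     (p Fin.≟ p′ ×-dec q Fin.≟ q′)

  edges : List (B n) → List Edge
  edges []             = []
  edges (𝟎 ∷ S)        = edges S
  edges (pair p q ∷ S) = (p , q) ∷ edges S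

  ∈-edges⁺ : ∀ {S p q} → pair p q ∈ S → (p , q) ∈ edges S
  ∈-edges⁺ {𝟎 ∷ S}        (there m)   = ∈-edges⁺ m
  ∈-edges⁺ {pair _ _ ∷ S} (here refl) = here refl
  ∈-edges⁺ {pair _ _ ∷ S} (there m)   = there (∈-edges⁺ m)

  ∈-edges⁻ : ∀ {S p q} → (p , q) ∈ edges S → pair p q ∈ S
  ∈-edges⁻ {𝟎 ∷ S}        m           = there (∈-edges⁻ m)
  ∈-edges⁻ {pair _ _ ∷ S} (here refl) = here refl
  ∈-edges⁻ {pair _ _ ∷ S} (there m)   = there (∈-edges⁻ m)

  toB : Edge → B n
  toB (p , q) = pair p q

  edges-map : ∀ L → edges (map toB L) ≡ L
  edges-map []            = refl
  edges-map ((p , q) ∷ L) = cong ((p , q) ∷_) (edges-map L)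

  edges-∷ʳ-𝟎 : ∀ S → edges (S ++ 𝟎 ∷ []) ≡ edges S
  edges-∷ʳ-𝟎 []             = refl
  edges-∷ʳ-𝟎 (𝟎 ∷ S)        = edges-∷ʳ-𝟎 S
  edges-∷ʳ-𝟎 (pair p q ∷ S) = cong ((p , q) ∷_) (edges-∷ʳ-𝟎 S)

  generated-⊆ : ∀ {S T : List (B n)} → (∀ {x} → x ∈ S → ⟨ T ⟩⁺ x) → ∀ {s} → ⟨ S ⟩⁺ s → ⟨ T ⟩⁺ s
  generated-⊆ S⊆T (gen m)   = S⊆T m
  generated-⊆ S⊆T (mul x y) = mul (generated-⊆ S⊆T x) (generated-⊆ S⊆T y)

  generated-mono : ∀ {S T : List (B n)} → S ⊆ T → ∀ {s} → ⟨ S ⟩⁺ s → ⟨ T ⟩⁺ s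
  generated-mono S⊆T = generated-⊆ (gen ∘ S⊆T)

  nothing-generated-by-[] : ∀ {s : B n} → ¬ ⟨ [] ⟩⁺ s
  nothing-generated-by-[] (gen ())
  nothing-generated-by-[] (mul x _) = nothing-generated-by-[] x

  WalkFor : List (B n) → B n → Set
  WalkFor S 𝟎          = ⊤
  WalkFor S (pair p q) = Path (edges S) p q

  walkFor-· : ∀ {S s t} → WalkFor S s → WalkFor S t → WalkFor S (s · t)
  walkFor-· {s = 𝟎}                           _ _ = tt
  walkFor-· {s = pair _ _} {𝟎}                _ _ = tt
  walkFor-· {s = pair i j} {pair k l} x y with j Fin.≟ k
  ... | yes refl = x ▸ y
  ... | no  _    = tt

  generator-walk : ∀ {S} s → s ∈ S → WalkFor S s
  generator-walk 𝟎          _ = tt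
  generator-walk (pair p q) m = edge (∈-edges⁺ m)

  generated⇒walk : ∀ {S s} → ⟨ S ⟩⁺ s → WalkFor S s
  generated⇒walk (gen m)   = generator-walk _ m
  generated⇒walk (mul x y) = walkFor-· (generated⇒walk x) (generated⇒walk y)

  ·-compose : ∀ (p r q : Fin n) → pair p r · pair r q ≡ pair p q
  ·-compose p r q with r Fin.≟ r
  ... | yes _  = refl
  ... | no r≢r = ⊥-elim (r≢r refl)

  walk⇒generated : ∀ {S p q} → Path (edges S) p q → ⟨ S ⟩⁺ (pair p q)
  walk⇒generated (edge m) = gen (∈-edges⁻ m)
  walk⇒generated {S} (_▸_ {p} {r} {q} x y) =
    subst ⟨ S ⟩⁺ (·-compose p r q) (mul (walk⇒generated x) (walk⇒generated y))

  strict-step⁻ : ∀ {K x} → ⟨ K ⟩⁺ ⊂ₚ ⟨ K ++ x ∷ [] ⟩⁺ → ¬ ⟨ K ⟩⁺ x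
  strict-step⁻ {K} (_ , s , s∈ , s∉) Kx = s∉ (generated-⊆ gens s∈)
    where
    gens : ∀ {y} → y ∈ K ++ _ ∷ [] → ⟨ K ⟩⁺ y
    gens m with ∈-++⁻ K m
    ... | inj₁ y∈K         = gen y∈K
    ... | inj₂ (here refl) = Kx

  strict-step⁺ : ∀ {K x} → ¬ ⟨ K ⟩⁺ x → ⟨ K ⟩⁺ ⊂ₚ ⟨ K ++ x ∷ [] ⟩⁺
  strict-step⁺ {K} {x} x-new = (λ _ → generated-mono ∈-++⁺ˡ) , x , gen (∈-++⁺ʳ K (here refl)) , x-new

  StrictChainFrom : List (B n) → List (B n) → Set
  StrictChainFrom K e =
    (i : Fin (length e)) → ⟨ K ++ take (toℕ i) e ⟩⁺ ⊂ₚ ⟨ K ++ take (suc (toℕ i)) e ⟩⁺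

  NewFrom : List (B n) → List (B n) → Set
  NewFrom K []      = ⊤
  NewFrom K (x ∷ e) = ¬ ⟨ K ⟩⁺ x × NewFrom (K ++ x ∷ []) e

  private
    regroup : ∀ K x (l : List (B n)) → (K ++ x ∷ []) ++ l ≡ K ++ x ∷ l
    regroup K x l = ++-assoc K (x ∷ []) l

  chain⇒new : ∀ K e → StrictChainFrom K e → NewFrom K e
  chain⇒new K []      _     = tt
  chain⇒new K (x ∷ e) chain =
    strict-step⁻ (subst (λ S → ⟨ S ⟩⁺ ⊂ₚ ⟨ K ++ x ∷ [] ⟩⁺) (++-identityʳ K) (chain Fin.zero)) ,
    chain⇒new (K ++ x ∷ []) e λ i →
      subst₂ (λ S T → ⟨ S ⟩⁺ ⊂ₚ ⟨ T ⟩⁺) (sym (regroup K x (take (toℕ i) e)))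
             (sym (regroup K x (take (suc (toℕ i)) e))) (chain (Fin.suc i))

  new⇒chain : ∀ K e → NewFrom K e → StrictChainFrom K e
  new⇒chain K (x ∷ e) (x-new , _) Fin.zero =
    subst (λ S → ⟨ S ⟩⁺ ⊂ₚ ⟨ K ++ x ∷ [] ⟩⁺) (sym (++-identityʳ K)) (strict-step⁺ x-new)
  new⇒chain K (x ∷ e) (_ , rest) (Fin.suc i) =
    subst₂ (λ S T → ⟨ S ⟩⁺ ⊂ₚ ⟨ T ⟩⁺) (regroup K x (take (toℕ i) e))
           (regroup K x (take (suc (toℕ i)) e)) (new⇒chain (K ++ x ∷ []) e rest i)

  Fresh : List (B n) → Set
  Fresh []      = ⊤
  Fresh (x ∷ S) = ¬ ⟨ S ⟩⁺ x × Fresh S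

  fresh-suffix : ∀ e {R} → Fresh (e ʳ++ R) → Fresh R
  fresh-suffix []      f = f
  fresh-suffix (x ∷ e) f = proj₂ (fresh-suffix e f)

  new⇒fresh : ∀ {K R} e → NewFrom K e → R ⊆ K → Fresh R → Fresh (e ʳ++ R)
  new⇒fresh []      _              _   fR = fR
  new⇒fresh {K} {R} (x ∷ e) (x-new , rest) R⊆K fR =
    new⇒fresh e rest xR⊆ (x-new ∘ generated-mono R⊆K , fR)
    where
    xR⊆ : x ∷ R ⊆ K ++ x ∷ []
    xR⊆ (here refl) = ∈-++⁺ʳ K (here refl)
    xR⊆ (there m)   = ∈-++⁺ˡ (R⊆K m)

  fresh⇒new : ∀ {K R} e → Fresh (e ʳ++ R) → K ⊆ R → NewFrom K e
  fresh⇒new []      _ _ = tt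
  fresh⇒new {K} {R} (x ∷ e) f K⊆R =
    proj₁ (fresh-suffix e f) ∘ generated-mono K⊆R , fresh⇒new e f Kx⊆
    where
    Kx⊆ : K ++ x ∷ [] ⊆ x ∷ R
    Kx⊆ m with ∈-++⁻ K m
    ... | inj₁ y∈K         = there (K⊆R y∈K)
    ... | inj₂ (here refl) = here refl

  chain⇒fresh : ∀ e → ChainEnumeration e → Fresh (reverse e)
  chain⇒fresh e chain = new⇒fresh e (chain⇒new [] e chain) (λ ()) tt

  fresh⇒chain : ∀ e → Fresh (reverse e) → ChainEnumeration e
  fresh⇒chain e f = new⇒chain [] e (fresh⇒new e f (λ ()))

  fresh⇒independent : ∀ S → Fresh S → Independent (edges S)
  fresh⇒independent []             _          = tt
  fresh⇒independent (𝟎 ∷ S)        (_ , f)    = fresh⇒independent S f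
  fresh⇒independent (pair p q ∷ S) (new , f) = new ∘ walk⇒generated , fresh⇒independent S f

  independent⇒fresh : ∀ L → Independent L → Fresh (map toB L ++ 𝟎 ∷ [])
  independent⇒fresh []            _         = nothing-generated-by-[] , tt
  independent⇒fresh ((p , q) ∷ L) (pq⇏ , iL) =
    (λ g → pq⇏ (subst (λ E → Path E p q) edges-L (generated⇒walk g))) , independent⇒fresh L iL
    where
    edges-L : edges (map toB L ++ 𝟎 ∷ []) ≡ L
    edges-L = trans (edges-∷ʳ-𝟎 (map toB L)) (edges-map L)

  face⇒independent : ∀ {X} → IsFace X → IndependentSet (edges X)
  face⇒independent {X} (_ , e , e↭X , chain) =
    edges (reverse e) , fresh⇒independent (reverse e) (chain⇒fresh e chain) , ⊆X , X⊆
    where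
    rev↭X : reverse e ↭ X
    rev↭X = ↭-trans (↭-reverse e) e↭X
    ⊆X : edges (reverse e) ⊆ edges X
    ⊆X m = ∈-edges⁺ (∈-resp-↭ rev↭X (∈-edges⁻ m))
    X⊆ : edges X ⊆ edges (reverse e)
    X⊆ m = ∈-edges⁺ (∈-resp-↭ (↭-sym rev↭X) (∈-edges⁻ m))

  -- 0 together with an independent edge list is a face: enumerate 0 first and
  -- then the edges, earliest first.
  independent⇒face : ∀ {L} → Independent L → IsFace (𝟎 ∷ map toB L)
  independent⇒face {L} iL =
    unique , 𝟎 ∷ reverse (map toB L) , prep 𝟎 (↭-reverse (map toB L)) , fresh⇒chain _ fresh
    where
    𝟎∉ : ∀ {z} → z ∈ map toB L → 𝟎 ≢ z
    𝟎∉ m 𝟎≡z with ∈-map⁻ toB m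
    ... | _ , _ , refl with 𝟎≡z
    ...   | ()
    toB-injective : ∀ {e f} → toB e ≡ toB f → e ≡ f
    toB-injective refl = refl
    unique : Unique (𝟎 ∷ map toB L)
    unique = All.tabulate 𝟎∉ ∷ Unique.map⁺ toB-injective (independent-unique iL)
    fresh : Fresh (reverse (𝟎 ∷ reverse (map toB L)))
    fresh = subst Fresh (sym (trans (ʳ++-defn (reverse (map toB L)))
                                    (cong (_++ 𝟎 ∷ []) (reverse-involutive (map toB L)))))
                  (independent⇒fresh L iL)

  Vertices : List (Fin n)
  Vertices = allFin n

  within-Vertices : ∀ L → Within Vertices L
  within-Vertices L _ = ∈-allFin _ , ∈-allFin _

  ⊆-𝟎-and : ∀ {X L} → edges X ⊆ L → X ⊆ 𝟎 ∷ map toB L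
  ⊆-𝟎-and {_} _   {𝟎}        _ = here refl
  ⊆-𝟎-and {_} X⊆L {pair p q} m = there (∈-map⁺ toB (X⊆L (∈-edges⁺ m)))

  maximal⇒facet : ∀ {F} → MaximalOn Vertices F → IsFacet (𝟎 ∷ map toB F)
  maximal⇒facet {F} (iF , _ , maxF) = independent⇒face iF , λ Y faceY F⊆Y → bigger Y faceY F⊆Y
    where
    bigger : ∀ Y → IsFace Y → 𝟎 ∷ map toB F ⊆ Y → Y ⊆ 𝟎 ∷ map toB F
    bigger Y faceY F⊆Y with face⇒independent faceY
    ... | LY , iLY , _ , ⊆LY =
      ⊆-𝟎-and (maxF LY iLY (within-Vertices LY) F⊆LY ∘ ⊆LY)
      where
      F⊆LY : F ⊆ LY
      F⊆LY m = ⊆LY (∈-edges⁺ (F⊆Y (there (∈-map⁺ toB m))))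

  facet⇒maximal : ∀ {X} → IsFacet X → ∃ λ L → MaximalOn Vertices L × length X ≡ suc (length L)
  facet⇒maximal {X} (faceX , maxX) with face⇒independent faceX
  ... | L , iL , _ , ⊆L = L , (iL , within-Vertices L , maximal) , length-X
    where
    maximal : ∀ L′ → Independent L′ → Within Vertices L′ → L ⊆ L′ → L′ ⊆ L
    maximal L′ iL′ _ L⊆L′ m =
      ⊆L (∈-edges⁺ (maxX (𝟎 ∷ map toB L′) (independent⇒face iL′) (⊆-𝟎-and (L⊆L′ ∘ ⊆L))
                         (there (∈-map⁺ toB m))))
    length-X : length X ≡ suc (length L)
    length-X = trans (UniqueLists.unique-length-≡ _≟B_ (proj₁ faceX) (proj₁ (independent⇒face iL))
                                                  (⊆-𝟎-and ⊆L) (maxX _ (independent⇒face iL) (⊆-𝟎-and ⊆L)))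
                     (cong suc (length-map toB L))

proposition5p15 : (n : ℕ) → n ≥ 1 →
    (∃ λ (X : List (B n)) → IsFacet X)
    × ((X : List (B n)) → IsFacet X → length X ≡ n C 2 + 2 * n)
proposition5p15 n@(suc _) _ = facet-exists , facet-size
  where
  open Brandt n
  open Digraph (Fin._≟_ {n}) using (maximal-exists; maximal-size)

  facet-exists : ∃ λ (X : List (B n)) → IsFacet X
  facet-exists with maximal-exists Vertices
  ... | F , maxF = 𝟎 ∷ map toB F , maximal⇒facet maxF

  facet-size : (X : List (B n)) → IsFacet X → length X ≡ facetSize n
  facet-size X facetX with facet⇒maximal facetX
  ... | L , maxL , length-X = begin
    length X                           ≡⟨ length-X ⟩
    suc (length L)                     ≡⟨ maximal-size (Unique.allFin⁺ n) (∈-allFin Fin.zero) maxL ⟩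
    facetSize (length (allFin n))      ≡⟨ cong facetSize (length-tabulate {n = n} id) ⟩
    facetSize n                        ∎
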